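{- For every $\gamma\in\{0,1,3,5,7,8,9,10\}$ and $\delta=10-\gamma$, there is a 2-factorization of the complete graph $K_{21}$ consisting of exactly $\gamma$ $C_3$-factors and $\delta$ $C_7$-factors.
   Context: A $C_k$-factor of a graph $G$ is a spanning subgraph of $G$ each of whose components is a cycle of length $k$. A 2-factorization of $G$ is a partition of the edge set of $G$ into spanning 2-regular subgraphs (2-factors). -}

module Defs where

open import Data.Nat using (ℕ; suc; _≤_; _+_)
open import Data.Nat.DivMod using (_mod_)
open import Data.Fin using (Fin; toℕ)
open import Data.Sum using (_⊎_; inj₁; inj₂)
open import Data.Product using (Σ; ∃; _×_; _,_)
open import Relation.Binary.PropositionalEquality using (_≡_)
open import Relation.Nullary using (¬_)

nxt : ∀ {k} → Fin k → Fin k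
nxt {suc k} i = suc (toℕ i) mod (suc k)

-- A C_k-factor of the complete graph on vertex set Fin n, presented by its
-- components: m cycles, cycle c visiting vertices (cyc c 0, cyc c 1, ..., cyc c (k-1))
-- in cyclic order.
record CFactor (n k : ℕ) : Set where
  field
    len≥3  : 3 ≤ k
    m      : ℕ
    cyc    : Fin m → Fin k → Fin n
    cover  : ∀ (v : Fin n) → Σ (Fin m) λ c → Σ (Fin k) λ i → cyc c i ≡ v
    unique : ∀ c i c′ i′ → cyc c i ≡ cyc c′ i′ → (c ≡ c′) × (i ≡ i′)

Adj : ∀ {n k} → CFactor n k → Fin n → Fin n → Set
Adj {n} {k} F u v =
  Σ (Fin m) λ c → Σ (Fin k) λ i →
    ((cyc c i ≡ u) × (cyc c (nxt i) ≡ v)) ⊎ ((cyc c i ≡ v) × (cyc c (nxt i) ≡ u))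
  where open CFactor F

AdjIn : ∀ {n p q γ δ} → (Fin γ → CFactor n p) → (Fin δ → CFactor n q) →
        Fin γ ⊎ Fin δ → Fin n → Fin n → Set
AdjIn fp fq (inj₁ j) = Adj (fp j)
AdjIn fp fq (inj₂ j) = Adj (fq j)

record Factorization (n p q γ δ : ℕ) : Set where
  field
    fp : Fin γ → CFactor n p
    fq : Fin δ → CFactor n q
    partition : ∀ (u v : Fin n) → ¬ (u ≡ v) →
      Σ (Fin γ ⊎ Fin δ) λ j → AdjIn fp fq j u v × (∀ j′ → AdjIn fp fq j′ u v → j′ ≡ j)

-- Identify the vertices of K₂₁ with ℤ₃ × ℤ₇ and let ℤ₇ act by translating the second
-- coordinate.  Two kinds of factors are invariant under this action: the triangle factors
-- {(0,x), (1,x+s), (2,x+t)} and the heptagon factors whose cycles run through each level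
-- {a} × ℤ₇ with a fixed step dₐ.  Together with the seven translates of one base factor
-- (and two further heptagon factors when γ = 5) they give, for each admissible γ, ten
-- factors covering every edge exactly once.  Both the factor property and the edge
-- partition are decidable for explicit data and are checked by evaluation; a translate
-- inherits the factor property from its base.
module Submission where

open import Defs
open import Data.Bool using (true; false)
open import Data.Empty using (⊥-elim)
open import Data.Fin using (Fin; zero; suc; toℕ; #_)
open import Data.Fin.Permutation using (Permutation′; permutation; _⟨$⟩ʳ_; _⟨$⟩ˡ_; inverseˡ; inverseʳ)
open import Data.Fin.Properties using (_≟_; any?; all?)
open import Data.List using (_∷_; [])
open import Data.List.Membership.Propositional using (_∈_)
open import Data.List.Relation.Unary.Any using (here; there)
open import Data.Nat using (ℕ; suc; _+_; _*_; _∸_; _≤?_)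
open import Data.Nat.DivMod using (_mod_; _/_)
open import Data.Product using (Σ; ∃; _×_; _,_; proj₁; proj₂) renaming (map to map×)
open import Data.Product.Properties using (,-injective) renaming (≡-dec to ≡-dec×)
open import Data.Sum using (_⊎_; inj₁; inj₂; [_,_]) renaming (map to map⊎)
open import Data.Sum.Properties using () renaming (≡-dec to ≡-dec⊎)
open import Data.Unit using (tt)
open import Data.Vec using (Vec; _∷_; []; lookup; tabulate) renaming (_++_ to _++ᵛ_)
open import Data.Vec.Properties using (lookup∘tabulate)
open import Function using (id; _∘_; _⇔_; mk⇔; Equivalence)
open import Relation.Binary.PropositionalEquality using (_≡_; refl; sym; trans; cong; cong₂)
open import Relation.Nullary using (¬_; Dec; _because_; invert)
open import Relation.Nullary.Decidable using (True; toWitness; map′; _×-dec_; _⊎-dec_; _→-dec_; ¬?)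
import Relation.Unary as U

any⊎? : ∀ {γ δ p} {P : U.Pred (Fin γ ⊎ Fin δ) p} → U.Decidable P → Dec (∃ P)
any⊎? {P = P} P? = map′ [ (λ (j , pj) → inj₁ j , pj) , (λ (j , pj) → inj₂ j , pj) ] split
  (any? (P? ∘ inj₁) ⊎-dec any? (P? ∘ inj₂))
  where
  split : ∃ P → (∃ (P ∘ inj₁)) ⊎ (∃ (P ∘ inj₂))
  split (inj₁ j , pj) = inj₁ (j , pj)
  split (inj₂ j , pj) = inj₂ (j , pj)

all⊎? : ∀ {γ δ p} {P : U.Pred (Fin γ ⊎ Fin δ) p} → U.Decidable P → Dec (∀ j → P j)
all⊎? P? = map′ (λ (all₁ , all₂) → [ all₁ , all₂ ]) (λ all → all ∘ inj₁ , all ∘ inj₂)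
  (all? (P? ∘ inj₁) ×-dec all? (P? ∘ inj₂))

-- The first i with P i; the given witness only rules out running past the end.
first : ∀ {m p} {P : U.Pred (Fin m) p} → U.Decidable P → ∃ P → ∃ P
first {suc m} P? ∃P with P? zero
... | true  because [P0]  = zero , invert [P0]
... | false because [¬P0] = map× suc id (first (P? ∘ suc) (later ∃P))
  where
  later : ∃ _ → ∃ _
  later (zero , P0)  = ⊥-elim (invert [¬P0] P0)
  later (suc i , Pi) = i , Pi

CycleTable : ℕ → ℕ → ℕ → Set
CycleTable n k m = Fin m → Fin k → Fin n

module _ {n k m : ℕ} (cyc : CycleTable n k m) where

  Covers : Set
  Covers = ∀ v → Σ (Fin m) λ c → Σ (Fin k) λ i → cyc c i ≡ v

  covers? : Dec Covers
  covers? = all? λ v → any? λ c → any? λ i → cyc c i ≟ v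

  position : Covers → Fin n → Fin m × Fin k
  position cover v = proj₁ (cover v) , proj₁ (proj₂ (cover v))

  FoundInPlace : Covers → Set
  FoundInPlace cover = ∀ c i → position cover (cyc c i) ≡ (c , i)

  foundInPlace? : ∀ cover → Dec (FoundInPlace cover)
  foundInPlace? cover = all? λ c → all? λ i → ≡-dec× _≟_ _≟_ (position cover (cyc c i)) (c , i)

  foundInPlace⇒unique : ∀ cover → FoundInPlace cover →
    ∀ c i c′ i′ → cyc c i ≡ cyc c′ i′ → (c ≡ c′) × (i ≡ i′)
  foundInPlace⇒unique cover inPlace c i c′ i′ eq =
    ,-injective (trans (sym (inPlace c i)) (trans (cong (position cover) eq) (inPlace c′ i′)))

fromTable : ∀ {n k m} (cyc : CycleTable n k m) {k≥3 : True (3 ≤? k)} {cover : True (covers? cyc)}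
  {inPlace : True (foundInPlace? cyc (toWitness {a? = covers? cyc} cover))} → CFactor n k
fromTable {m = m} cyc {k≥3} {cover} {inPlace} = record
  { len≥3  = toWitness k≥3
  ; m      = m
  ; cyc    = cyc
  ; cover  = toWitness cover
  ; unique = foundInPlace⇒unique cyc (toWitness {a? = covers? cyc} cover) (toWitness inPlace)
  }

fromRows : ∀ {n k m} → Vec (Vec (Fin n) k) m → CycleTable n k m
fromRows rows c i = lookup (lookup rows c) i

relabel : ∀ {n k} → Permutation′ n → CFactor n k → CFactor n k
relabel π F = record
  { len≥3  = len≥3
  ; m      = m
  ; cyc    = λ c i → π ⟨$⟩ʳ cyc c i
  ; cover  = λ v → let (c , i , e) = cover (π ⟨$⟩ˡ v) in
               c , i , trans (cong (π ⟨$⟩ʳ_) e) (inverseʳ π)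
  ; unique = λ c i c′ i′ e →
               unique c i c′ i′ (trans (sym (inverseˡ π)) (trans (cong (π ⟨$⟩ˡ_) e) (inverseˡ π)))
  }
  where open CFactor F

module _ {n k} (F : CFactor n k) where
  open CFactor F

  -- Positions are found by linear search instead of being read off cover, whose
  -- witnesses are costly to evaluate when cover comes from a decision procedure.
  locate : ∀ v → Σ (Fin m) λ c → Σ (Fin k) λ i → cyc c i ≡ v
  locate v = let (c , ∃i) = first (λ c → any? λ i → cyc c i ≟ v) (cover v) in
    c , first (λ i → cyc c i ≟ v) ∃i

  successor : Fin n → Fin n
  successor v = let (c , i , _) = locate v in cyc c (nxt i)

  successor-cyc : ∀ c i → successor (cyc c i) ≡ cyc c (nxt i)
  successor-cyc c i = let (c′ , i′ , e) = locate (cyc c i) ; (c′≡c , i′≡i) = unique c′ i′ c i e in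
    cong₂ (λ c i → cyc c (nxt i)) c′≡c i′≡i

  adj⇔successor : ∀ {u v} → Adj F u v ⇔ (successor u ≡ v ⊎ successor v ≡ u)
  adj⇔successor = mk⇔ to from
    where
    to : ∀ {u v} → Adj F u v → successor u ≡ v ⊎ successor v ≡ u
    to (c , i , inj₁ (refl , refl)) = inj₁ (successor-cyc c i)
    to (c , i , inj₂ (refl , refl)) = inj₂ (successor-cyc c i)
    from : ∀ {u v} → successor u ≡ v ⊎ successor v ≡ u → Adj F u v
    from {u} (inj₁ refl) = let (c , i , e) = locate u in c , i , inj₁ (e , refl)
    from {v = v} (inj₂ refl) = let (c , i , e) = locate v in c , i , inj₂ (e , refl)

module _ {n p q γ δ : ℕ} (fp : Fin γ → CFactor n p) (fq : Fin δ → CFactor n q) where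

  successorIn : Fin γ ⊎ Fin δ → Fin n → Fin n
  successorIn (inj₁ j) = successor (fp j)
  successorIn (inj₂ j) = successor (fq j)

  adjIn⇔successorIn : ∀ j {u v} → AdjIn fp fq j u v ⇔ (successorIn j u ≡ v ⊎ successorIn j v ≡ u)
  adjIn⇔successorIn (inj₁ j) = adj⇔successor (fp j)
  adjIn⇔successorIn (inj₂ j) = adj⇔successor (fq j)

  EdgePartition : Set
  EdgePartition = ∀ u v → ¬ u ≡ v →
    Σ (Fin γ ⊎ Fin δ) λ j → AdjIn fp fq j u v × (∀ j′ → AdjIn fp fq j′ u v → j′ ≡ j)

  module _ (succ : Fin γ ⊎ Fin δ → Fin n → Fin n) (succ≡ : ∀ j u → succ j u ≡ successorIn j u) where

    adjIn? : ∀ j u v → Dec (AdjIn fp fq j u v)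
    adjIn? j u v = map′ (from ∘ map⊎ (trans (sym (succ≡ j u))) (trans (sym (succ≡ j v))))
                        (map⊎ (trans (succ≡ j u)) (trans (succ≡ j v)) ∘ to)
                        ((succ j u ≟ v) ⊎-dec (succ j v ≟ u))
      where open Equivalence (adjIn⇔successorIn j)

    edgePartitionWith? : Dec EdgePartition
    edgePartitionWith? = all? λ u → all? λ v → ¬? (u ≟ v) →-dec
      any⊎? λ j → adjIn? j u v ×-dec all⊎? λ j′ → adjIn? j′ u v →-dec ≡-dec⊎ _≟_ _≟_ j′ j

  -- Passed to edgePartitionWith? as an argument, the tabulated successors are
  -- computed once during the exhaustive check rather than once per query.
  successorTable : Fin γ ⊎ Fin δ → Fin n → Fin n
  successorTable =
    lookupIn (tabulate λ j → tabulate (successor (fp j))) (tabulate λ j → tabulate (successor (fq j)))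
    where
    lookupIn : Vec (Vec (Fin n) n) γ → Vec (Vec (Fin n) n) δ → Fin γ ⊎ Fin δ → Fin n → Fin n
    lookupIn sp sq (inj₁ j) u = lookup (lookup sp j) u
    lookupIn sp sq (inj₂ j) u = lookup (lookup sq j) u

  successorTable≡ : ∀ j u → successorTable j u ≡ successorIn j u
  successorTable≡ (inj₁ j) u = trans (cong (λ row → lookup row u) (lookup∘tabulate _ j)) (lookup∘tabulate _ u)
  successorTable≡ (inj₂ j) u = trans (cong (λ row → lookup row u) (lookup∘tabulate _ j)) (lookup∘tabulate _ u)

  edgePartition? : Dec EdgePartition
  edgePartition? = edgePartitionWith? successorTable successorTable≡

fromFactors : ∀ {n p q γ δ} (ps : Vec (CFactor n p) γ) (qs : Vec (CFactor n q) δ) →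
  {True (edgePartition? (lookup ps) (lookup qs))} → Factorization n p q γ δ
fromFactors ps qs {partition} =
  record { fp = lookup ps ; fq = lookup qs ; partition = toWitness partition }

infixl 6 _⊕_
infixl 7 _⊗_

_⊕_ : Fin 7 → Fin 7 → Fin 7
x ⊕ y = (toℕ x + toℕ y) mod 7

_⊗_ : Fin 7 → Fin 7 → Fin 7
x ⊗ y = (toℕ x * toℕ y) mod 7

⊖_ : Fin 7 → Fin 7
⊖ x = (7 ∸ toℕ x) mod 7

vertex : Fin 3 → Fin 7 → Fin 21
vertex a x = (7 * toℕ a + toℕ x) mod 21

translate : Fin 7 → Fin 21 → Fin 21
translate t v = vertex ((toℕ v / 7) mod 3) ((toℕ v mod 7) ⊕ t)

translate-⊖ : ∀ t v → translate t (translate (⊖ t) v) ≡ v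
translate-⊖ = toWitness {a? = all? λ t → all? λ v → translate t (translate (⊖ t) v) ≟ v} tt

⊖-translate : ∀ t v → translate (⊖ t) (translate t v) ≡ v
⊖-translate = toWitness {a? = all? λ t → all? λ v → translate (⊖ t) (translate t v) ≟ v} tt

translation : Fin 7 → Permutation′ 21
translation t = permutation (translate t) (translate (⊖ t)) (translate-⊖ t) (⊖-translate t)

orbit : ∀ {k} → CFactor 21 k → Vec (CFactor 21 k) 7
orbit F = tabulate λ t → relabel (translation t) F

transversal : Fin 7 → Fin 7 → CycleTable 21 3 7
transversal s t x a = vertex a (x ⊕ lookup (zero ∷ s ∷ t ∷ []) a)

levelCycles : Vec (Fin 7) 3 → CycleTable 21 7 3
levelCycles d a i = vertex a (i ⊗ lookup d a)

heptagons₀ : CFactor 21 7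
heptagons₀ = fromTable (fromRows
  ( (# 0 ∷ # 10 ∷ # 1 ∷ # 13 ∷ # 2 ∷ # 14 ∷ # 8 ∷ [])
  ∷ (# 3 ∷ # 17 ∷ # 12 ∷ # 6 ∷ # 16 ∷ # 9 ∷ # 19 ∷ [])
  ∷ (# 4 ∷ # 15 ∷ # 7 ∷ # 18 ∷ # 5 ∷ # 20 ∷ # 11 ∷ [])
  ∷ []))

heptagons₁ : CFactor 21 7
heptagons₁ = fromTable (fromRows
  ( (# 0 ∷ # 20 ∷ # 2 ∷ # 12 ∷ # 1 ∷ # 13 ∷ # 4 ∷ [])
  ∷ (# 3 ∷ # 11 ∷ # 17 ∷ # 8 ∷ # 16 ∷ # 19 ∷ # 9 ∷ [])
  ∷ (# 5 ∷ # 15 ∷ # 10 ∷ # 7 ∷ # 18 ∷ # 6 ∷ # 14 ∷ [])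
  ∷ []))

heptagons₃ : CFactor 21 7
heptagons₃ = fromTable (fromRows
  ( (# 0 ∷ # 2 ∷ # 13 ∷ # 17 ∷ # 18 ∷ # 3 ∷ # 20 ∷ [])
  ∷ (# 1 ∷ # 5 ∷ # 6 ∷ # 11 ∷ # 16 ∷ # 4 ∷ # 7 ∷ [])
  ∷ (# 8 ∷ # 10 ∷ # 9 ∷ # 12 ∷ # 15 ∷ # 19 ∷ # 14 ∷ [])
  ∷ []))

heptagons₅ : CFactor 21 7
heptagons₅ = fromTable (fromRows
  ( (# 0 ∷ # 19 ∷ # 8 ∷ # 2 ∷ # 7 ∷ # 1 ∷ # 13 ∷ [])
  ∷ (# 3 ∷ # 15 ∷ # 11 ∷ # 14 ∷ # 10 ∷ # 20 ∷ # 9 ∷ [])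
  ∷ (# 4 ∷ # 16 ∷ # 12 ∷ # 6 ∷ # 18 ∷ # 5 ∷ # 17 ∷ [])
  ∷ []))

heptagons₅′ : CFactor 21 7
heptagons₅′ = fromTable (fromRows
  ( (# 0 ∷ # 12 ∷ # 15 ∷ # 2 ∷ # 14 ∷ # 1 ∷ # 20 ∷ [])
  ∷ (# 3 ∷ # 8 ∷ # 18 ∷ # 7 ∷ # 17 ∷ # 13 ∷ # 16 ∷ [])
  ∷ (# 4 ∷ # 9 ∷ # 19 ∷ # 6 ∷ # 11 ∷ # 5 ∷ # 10 ∷ [])
  ∷ []))

triangles₇ : CFactor 21 3
triangles₇ = fromTable (fromRows
  ( (# 0 ∷ # 7 ∷ # 16 ∷ [])
  ∷ (# 1 ∷ # 10 ∷ # 15 ∷ [])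
  ∷ (# 2 ∷ # 14 ∷ # 13 ∷ [])
  ∷ (# 3 ∷ # 20 ∷ # 9 ∷ [])
  ∷ (# 4 ∷ # 12 ∷ # 19 ∷ [])
  ∷ (# 5 ∷ # 8 ∷ # 18 ∷ [])
  ∷ (# 6 ∷ # 11 ∷ # 17 ∷ [])
  ∷ []))

triangles₈ : CFactor 21 3
triangles₈ = fromTable (fromRows
  ( (# 0 ∷ # 10 ∷ # 4 ∷ [])
  ∷ (# 1 ∷ # 18 ∷ # 9 ∷ [])
  ∷ (# 2 ∷ # 13 ∷ # 17 ∷ [])
  ∷ (# 3 ∷ # 15 ∷ # 12 ∷ [])
  ∷ (# 5 ∷ # 16 ∷ # 14 ∷ [])
  ∷ (# 6 ∷ # 19 ∷ # 11 ∷ [])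
  ∷ (# 7 ∷ # 8 ∷ # 20 ∷ [])
  ∷ []))

triangles₉ : CFactor 21 3
triangles₉ = fromTable (fromRows
  ( (# 0 ∷ # 15 ∷ # 12 ∷ [])
  ∷ (# 1 ∷ # 10 ∷ # 11 ∷ [])
  ∷ (# 2 ∷ # 8 ∷ # 4 ∷ [])
  ∷ (# 3 ∷ # 6 ∷ # 19 ∷ [])
  ∷ (# 5 ∷ # 17 ∷ # 16 ∷ [])
  ∷ (# 7 ∷ # 18 ∷ # 20 ∷ [])
  ∷ (# 9 ∷ # 14 ∷ # 13 ∷ [])
  ∷ []))

triangles₁₀ : CFactor 21 3
triangles₁₀ = fromTable (fromRows
  ( (# 0 ∷ # 1 ∷ # 3 ∷ [])
  ∷ (# 2 ∷ # 7 ∷ # 20 ∷ [])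
  ∷ (# 4 ∷ # 17 ∷ # 8 ∷ [])
  ∷ (# 5 ∷ # 11 ∷ # 15 ∷ [])
  ∷ (# 6 ∷ # 9 ∷ # 14 ∷ [])
  ∷ (# 10 ∷ # 12 ∷ # 13 ∷ [])
  ∷ (# 16 ∷ # 18 ∷ # 19 ∷ [])
  ∷ []))

factorization₀ : Factorization 21 3 7 0 10
factorization₀ = fromFactors []
  (fromTable (levelCycles (# 1 ∷ # 1 ∷ # 1 ∷ [])) ∷ fromTable (levelCycles (# 2 ∷ # 2 ∷ # 2 ∷ [])) ∷
   fromTable (levelCycles (# 3 ∷ # 3 ∷ # 3 ∷ [])) ∷ [] ++ᵛ orbit heptagons₀)

factorization₁ : Factorization 21 3 7 1 9
factorization₁ = fromFactors
  (fromTable (transversal (# 0) (# 0)) ∷ [])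
  (fromTable (levelCycles (# 1 ∷ # 1 ∷ # 1 ∷ [])) ∷ fromTable (levelCycles (# 2 ∷ # 2 ∷ # 2 ∷ [])) ∷ []
   ++ᵛ orbit heptagons₁)

factorization₃ : Factorization 21 3 7 3 7
factorization₃ = fromFactors
  (fromTable (transversal (# 0) (# 0)) ∷ fromTable (transversal (# 1) (# 2)) ∷
   fromTable (transversal (# 2) (# 4)) ∷ [])
  (orbit heptagons₃)

factorization₅ : Factorization 21 3 7 5 5
factorization₅ = fromFactors
  (fromTable (transversal (# 0) (# 0)) ∷ fromTable (transversal (# 1) (# 2)) ∷
   fromTable (transversal (# 2) (# 4)) ∷ fromTable (transversal (# 3) (# 1)) ∷
   fromTable (transversal (# 4) (# 3)) ∷ [])
  (fromTable (levelCycles (# 1 ∷ # 2 ∷ # 3 ∷ [])) ∷ fromTable (levelCycles (# 2 ∷ # 3 ∷ # 1 ∷ [])) ∷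
   fromTable (levelCycles (# 3 ∷ # 1 ∷ # 2 ∷ [])) ∷ heptagons₅ ∷ heptagons₅′ ∷ [])

factorization₇ : Factorization 21 3 7 7 3
factorization₇ = fromFactors
  (orbit triangles₇)
  (fromTable (levelCycles (# 1 ∷ # 1 ∷ # 1 ∷ [])) ∷ fromTable (levelCycles (# 2 ∷ # 2 ∷ # 2 ∷ [])) ∷
   fromTable (levelCycles (# 3 ∷ # 3 ∷ # 3 ∷ [])) ∷ [])

factorization₈ : Factorization 21 3 7 8 2
factorization₈ = fromFactors
  (fromTable (transversal (# 0) (# 0)) ∷ [] ++ᵛ orbit triangles₈)
  (fromTable (levelCycles (# 1 ∷ # 2 ∷ # 3 ∷ [])) ∷ fromTable (levelCycles (# 2 ∷ # 3 ∷ # 1 ∷ [])) ∷ [])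

factorization₉ : Factorization 21 3 7 9 1
factorization₉ = fromFactors
  (fromTable (transversal (# 0) (# 0)) ∷ fromTable (transversal (# 1) (# 3)) ∷ [] ++ᵛ orbit triangles₉)
  (fromTable (levelCycles (# 1 ∷ # 2 ∷ # 3 ∷ [])) ∷ [])

factorization₁₀ : Factorization 21 3 7 10 0
factorization₁₀ = fromFactors
  (fromTable (transversal (# 0) (# 0)) ∷ fromTable (transversal (# 1) (# 2)) ∷
   fromTable (transversal (# 2) (# 5)) ∷ [] ++ᵛ orbit triangles₁₀)
  []

lemma3p4 : ∀ (γ δ : ℕ) → γ ∈ (0 ∷ 1 ∷ 3 ∷ 5 ∷ 7 ∷ 8 ∷ 9 ∷ 10 ∷ []) → γ + δ ≡ 10 →
    Factorization 21 3 7 γ δ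
lemma3p4 .0  .10 (here refl) refl = factorization₀
lemma3p4 .1  .9  (there (here refl)) refl = factorization₁
lemma3p4 .3  .7  (there (there (here refl))) refl = factorization₃
lemma3p4 .5  .5  (there (there (there (here refl)))) refl = factorization₅
lemma3p4 .7  .3  (there (there (there (there (here refl))))) refl = factorization₇
lemma3p4 .8  .2  (there (there (there (there (there (here refl)))))) refl = factorization₈
lemma3p4 .9  .1  (there (there (there (there (there (there (here refl))))))) refl = factorization₉
lemma3p4 .10 .0  (there (there (there (there (there (there (there (here refl)))))))) refl = factorization₁₀
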